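{- Let $\alpha$ be a weak composition, $\varphi$ a flag, $i>0$, and $T\in\mathrm{SSKT}(\alpha,\varphi)$. Then $e_i(T)\in\mathrm{SSKT}(\alpha,\varphi)\sqcup\{0\}$.
   Context: Tableaux are fillings by positive integers of finite sets of boxes (row $r$, column $c\in\mathbb{Z}_{>0}$), rows left-justified, French notation (rows indexed increasing upward); $T_{rc}$ is the entry in row $r$, column $c$; the shape is the weak composition of row lengths. A flag is a weakly increasing $\varphi:\mathbb{Z}_{>0}\to\mathbb{Z}_{>0}$ with $\varphi(m)\ge m$. A key tableau is a tableau with (a) rows weakly decreasing left to right; (b) columns with distinct entries; (c) if boxes $(i,j),(k,j)$ with $i<k$ have $T_{ij}>T_{kj}$, then $(i,j+1)$ is a box and $T_{i,j+1}>T_{kj}$. It is $\varphi$-flagged if $T_{ij}\le\varphi(i)$ for all boxes; $\mathrm{SSKT}(\alpha,\varphi)$ is the set of $\varphi$-flagged key tableaux of shape $\alpha$ (rows of positive index). For a word $\rho=\rho_1\cdots\rho_k$, let $m_i(\rho,j)$ be the number of letters $i+1$ minus the number of letters $i$ in $\rho_j\rho_{j+1}\cdots\rho_k$, and $m_i(\rho)=\max_{1\le j\le k}m_i(\rho,j)$. The reverse column reading word $\mathsf{col}(T)$ reads the entries of $T$ down each column (top to bottom), columns taken from right to left. Raising operator: if $m_i(\mathsf{col}(T))\le0$ then $e_i(T)=0$; otherwise let $q$ be the largest index with $m_i(\mathsf{col}(T),q)=m_i(\mathsf{col}(T))$; $e_i(T)$ is obtained by first changing to $i$ all entries $i+1$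 lying to the right of (the box of) $\mathsf{col}(T)_q$ in the same row, and then changing to $i+1$ all entries $i$ in the same columns as these changed entries. -}

module Defs where

open import Data.Nat using (ℕ; zero; suc; _≤_; _<_; _⊔_; _≡ᵇ_; _≤ᵇ_)
open import Data.Integer as ℤ using (ℤ; +_; _-_)
open import Data.Integer.Properties as ℤP using ()
open import Data.Bool using (Bool; true; false; if_then_else_; _∧_)
open import Data.List using (List; []; _∷_; map; length; concatMap; downFrom; foldr)
open import Data.Maybe using (Maybe; just; nothing)
open import Data.Product using (Σ; _×_; _,_)
open import Relation.Nullary using (¬_; does)
open import Relation.Binary.PropositionalEquality using (_≡_)

-- A tableau: list of rows, the k-th element (k = 0,1,..) is row k+1
-- (French notation: row 1 at the bottom), each row a left-justified list of
-- entries (columns 1,2,...).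
Tableau : Set
Tableau = List (List ℕ)

WeakComposition : Set
WeakComposition = List ℕ

shape : Tableau → WeakComposition
shape = map length

nth : {A : Set} → List A → ℕ → Maybe A
nth []       _       = nothing
nth (x ∷ xs) zero    = just x
nth (x ∷ xs) (suc n) = nth xs n

-- entry T r c = T_{rc} (1-indexed rows and columns); nothing if no box.
entry : Tableau → ℕ → ℕ → Maybe ℕ
entry T zero    c       = nothing
entry T (suc r) zero    = nothing
entry T (suc r) (suc c) with nth T r
... | nothing  = nothing
... | just row = nth row c

-- Flag: weakly increasing φ : ℤ>0 → ℤ>0 with φ(m) ≥ m (values of φ at 0 irrelevant).
IsFlag : (ℕ → ℕ) → Set
IsFlag φ = (∀ m n → 1 ≤ m → m ≤ n → φ m ≤ φ n) × (∀ m → 1 ≤ m → m ≤ φ m)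

PositiveFilling : Tableau → Set
PositiveFilling T = ∀ r c x → entry T r c ≡ just x → 1 ≤ x

IsKey : Tableau → Set
IsKey T =
  (∀ r c x y → entry T r c ≡ just x → entry T r (suc c) ≡ just y → y ≤ x)
  × (∀ i k j x y → i < k → entry T i j ≡ just x → entry T k j ≡ just y → ¬ (x ≡ y))
  × (∀ i k j x y → i < k → entry T i j ≡ just x → entry T k j ≡ just y → y < x →
       Σ ℕ λ z → entry T i (suc j) ≡ just z × y < z)

Flagged : (ℕ → ℕ) → Tableau → Set
Flagged φ T = ∀ r c x → entry T r c ≡ just x → x ≤ φ r

SSKT : WeakComposition → (ℕ → ℕ) → Tableau → Set
SSKT α φ T = shape T ≡ α × PositiveFilling T × IsKey T × Flagged φ T

record Letter : Set where
  constructor letter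
  field
    row : ℕ
    col : ℕ
    val : ℕ
open Letter

maxCol : Tableau → ℕ
maxCol T = foldr _⊔_ 0 (shape T)

down1 : ℕ → List ℕ
down1 n = map suc (downFrom n)

-- reverse column reading word col(T): columns right to left, each column read
-- top to bottom (from highest row index to row 1).
colWord : Tableau → List Letter
colWord T = concatMap (λ c → concatMap (λ r → cell r c) (down1 (length T))) (down1 (maxCol T))
  where
  cell : ℕ → ℕ → List Letter
  cell r c with entry T r c
  ... | nothing = []
  ... | just v  = letter r c v ∷ []

count : ℕ → List Letter → ℕ
count a []       = 0
count a (x ∷ xs) = if val x ≡ᵇ a then suc (count a xs) else count a xs

-- m_i(ρ, j) for the suffix ρ_j ρ_{j+1} ⋯ ρ_k
mSuffix : ℕ → List Letter → ℤ
mSuffix i w = + count (suc i) w - + count i w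

mList : ℕ → List Letter → List (Letter × ℤ)
mList i []       = []
mList i (x ∷ xs) = (x , mSuffix i (x ∷ xs)) ∷ mList i xs

-- m_i(ρ) (the maximum, with 0 as default; only its positivity and value when
-- positive matter, and then it agrees with max_{1≤j≤k} m_i(ρ,j))
mMax : ℕ → List Letter → ℤ
mMax i w = foldr (λ p acc → Data.Product.proj₂ p ℤ.⊔ acc) (+ 0) (mList i w)

lastWith : ℤ → List (Letter × ℤ) → Maybe Letter
lastWith M []             = nothing
lastWith M ((x , v) ∷ xs) with lastWith M xs
... | just y  = just y
... | nothing = if does (v ℤ.≟ M) then just x else nothing

imapRows : (ℕ → ℕ → ℕ → ℕ) → Tableau → Tableau
imapRows f T = go 1 T
  where
  goRow : ℕ → ℕ → List ℕ → List ℕ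
  goRow r c []       = []
  goRow r c (v ∷ vs) = f r c v ∷ goRow r (suc c) vs
  go : ℕ → Tableau → Tableau
  go r []         = []
  go r (row ∷ rs) = goRow r 1 row ∷ go (suc r) rs

isJust≡ : Maybe ℕ → ℕ → Bool
isJust≡ nothing  a = false
isJust≡ (just x) a = x ≡ᵇ a

-- raising operator e_i; nothing represents 0.
-- The changed entries in the first step are the entries i+1 in the row of the
-- box of col(T)_q at columns weakly to the right of it (the box itself holds i+1).
raise : ℕ → Tableau → Maybe Tableau
raise i T with does (+ 0 ℤ.<? mMax i (colWord T))
... | false = nothing
... | true with lastWith (mMax i (colWord T)) (mList i (colWord T))
...   | nothing = nothing
...   | just (letter r0 c0 _) = just (imapRows step T)
  where
  colChanged : ℕ → Bool
  colChanged c = (c0 ≤ᵇ c) ∧ isJust≡ (entry T r0 c) (suc i)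
  step : ℕ → ℕ → ℕ → ℕ
  step r c v =
    if (r ≡ᵇ r0) ∧ (c0 ≤ᵇ c) ∧ (v ≡ᵇ suc i) then i
    else if colChanged c ∧ (v ≡ᵇ i) then suc i
    else v

module Submission where

-- The letter raised by e_i is an i + 1 in a box (r₀, c₀) such that the first box read
-- after it that holds i or i + 1 does not hold i: a later i would give a later index with
-- the same (maximal) value of m_i.  In a key tableau this controls the changed boxes.  The
-- entries i + 1 of row r₀ from column c₀ on form a run of consecutive columns; no column
-- of the run has an i below row r₀, and an i above row r₀ in one of its columns forces
-- the run to continue to the next column.  The key conditions for e_i(T) then follow by
-- a case analysis on whether the boxes involved were lowered (i + 1 to i), raised (i to
-- i + 1) or left fixed; the shape is unchanged, and a raised box lies above the box
-- (r₀, c) of its column, whose entry i + 1 was already bounded by the flag.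

open import Defs
open import Data.Bool using (true; false; if_then_else_; _∧_)
open import Data.Bool.Properties using (T-≡)
open import Data.Empty using (⊥-elim)
open import Data.Integer as ℤ using (ℤ; +_; _-_)
import Data.Integer.Properties as ℤₚ
open import Data.Integer.Tactic.RingSolver using (solve-∀)
open import Data.List using (List; []; _∷_; _++_; [_]; concatMap; length; map)
open import Data.List.Properties using (++-assoc)
open import Data.List.Membership.Propositional using (_∈_; lose)
open import Data.List.Membership.Propositional.Properties
  using (∈-++⁺ˡ; ∈-++⁺ʳ; ∈-++⁻; ∈-∃++; ∈-concatMap⁺; ∈-concatMap⁻)
open import Data.List.Relation.Unary.All as All using (All; []; _∷_)
import Data.List.Relation.Unary.All.Properties as All
open import Data.List.Relation.Unary.Any as Any using (here; there)
open import Data.List.Relation.Unary.AllPairs as AllPairs using (AllPairs; []; _∷_)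
import Data.List.Relation.Unary.AllPairs.Properties as AllPairs
open import Data.Maybe as Maybe using (Maybe; just; nothing)
open import Data.Maybe.Properties using (just-injective)
open import Data.Nat using (ℕ; zero; suc; _+_; _≤_; _<_; _>_; z≤n; s≤s; _≡ᵇ_; _≤ᵇ_)
import Data.Nat.Properties as ℕₚ
open import Data.Product using (Σ; ∃; ∃₂; _×_; _,_; proj₁; proj₂)
open import Data.Product.Relation.Binary.Lex.Strict using (×-Lex; ×-asymmetric)
open import Data.Sum using (_⊎_; inj₁; inj₂)
open import Function using (_∘_; _∋_; case_of_; Equivalence)
open import Relation.Binary using (tri<; tri≈; tri>)
open import Relation.Binary.Definitions using (Asymmetric)
open import Relation.Nullary using (¬_; yes; no; contradiction)
open import Relation.Nullary.Decidable using (dec-true; dec-false)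
open import Relation.Binary.PropositionalEquality hiding ([_])

private
  ≡ᵇ-true : ∀ {m n} → m ≡ n → (m ≡ᵇ n) ≡ true
  ≡ᵇ-true {m} {n} = dec-true (m ℕₚ.≟ n)

  ≡ᵇ-false : ∀ {m n} → m ≢ n → (m ≡ᵇ n) ≡ false
  ≡ᵇ-false {m} {n} = dec-false (m ℕₚ.≟ n)

  ≡ᵇ-true⁻ : ∀ m n → (m ≡ᵇ n) ≡ true → m ≡ n
  ≡ᵇ-true⁻ m n e = ℕₚ.≡ᵇ⇒≡ m n (Equivalence.from T-≡ e)

  ≤ᵇ-true : ∀ m n → m ≤ n → (m ≤ᵇ n) ≡ true
  ≤ᵇ-true m n = dec-true (m ℕₚ.≤? n)

  ≤ᵇ-true⁻ : ∀ m n → (m ≤ᵇ n) ≡ true → m ≤ n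
  ≤ᵇ-true⁻ m n e = ℕₚ.≤ᵇ⇒≤ m n (Equivalence.from T-≡ e)

  ∧-true⁻ : ∀ {a b} → a ∧ b ≡ true → a ≡ true × b ≡ true
  ∧-true⁻ {true} {true} _ = refl , refl

  isJust≡-true⁻ : ∀ m {a} → isJust≡ m a ≡ true → m ≡ just a
  isJust≡-true⁻ (just x) e = cong just (≡ᵇ-true⁻ x _ e)

  if-true : ∀ {b} {x y : ℕ} → b ≡ true → (if b then x else y) ≡ x
  if-true refl = refl

  if-false : ∀ {b} {x y : ℕ} → b ≡ false → (if b then x else y) ≡ y
  if-false refl = refl

module _ {A : Set} {R : A → A → Set} where

  AllPairs-++⁻ : ∀ xs {ys} → AllPairs R (xs ++ ys) →
                 AllPairs R ys × (∀ {x y} → x ∈ xs → y ∈ ys → R x y)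
  AllPairs-++⁻ []       Rys         = Rys , λ ()
  AllPairs-++⁻ (x ∷ xs) (Rx ∷ Rxsys) with AllPairs-++⁻ xs Rxsys
  ... | Rys , Rxsys′ = Rys , λ { (here refl) y∈ → All.lookup Rx (∈-++⁺ʳ xs y∈)
                              ; (there x∈)  y∈ → Rxsys′ x∈ y∈ }

  AllPairs-concatMap⁺ : {B : Set} {Q : B → B → Set} (f : B → List A) {bs : List B} →
    AllPairs Q bs → (∀ b → AllPairs R (f b)) →
    (∀ {a b x y} → Q a b → x ∈ f a → y ∈ f b → R x y) → AllPairs R (concatMap f bs)
  AllPairs-concatMap⁺ f Qbs Rf cross = AllPairs.concat⁺
    (All.map⁺ (All.universal Rf _))
    (AllPairs.map⁺ (AllPairs.map (λ q → All.tabulate λ x∈ → All.tabulate λ y∈ → cross q x∈ y∈) Qbs))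

  AllPairs-between : Asymmetric R → ∀ xs {l ys p} → AllPairs R (xs ++ l ∷ ys) →
    p ∈ xs ++ l ∷ ys → R l p →
    ∃₂ λ ys₁ ys₂ → ys ≡ ys₁ ++ p ∷ ys₂ × All (λ z → R l z × R z p) ys₁
  AllPairs-between asym xs sorted p∈ Rlp with AllPairs-++⁻ xs sorted
  ... | Rl ∷ Rys , Rxs with ∈-++⁻ xs p∈
  ... | inj₁ p∈xs          = ⊥-elim (asym (Rxs p∈xs (here refl)) Rlp)
  ... | inj₂ (here refl)   = ⊥-elim (asym Rlp Rlp)
  ... | inj₂ (there p∈ys) with ∈-∃++ p∈ys
  ... | ys₁ , ys₂ , refl with AllPairs-++⁻ ys₁ Rys
  ... | _ , Rys₁ = ys₁ , ys₂ , refl ,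
    All.tabulate λ z∈ → All.lookup Rl (∈-++⁺ˡ z∈) , Rys₁ z∈ (here refl)

nth-just⇒< : ∀ {A : Set} (xs : List A) n {a} → nth xs n ≡ just a → n < length xs
nth-just⇒< (x ∷ xs) zero    _ = s≤s z≤n
nth-just⇒< (x ∷ xs) (suc n) e = s≤s (nth-just⇒< xs n e)

length≤maxCol : ∀ T n {row} → nth T n ≡ just row → length row ≤ maxCol T
length≤maxCol (row ∷ T) zero    refl = ℕₚ.m≤m⊔n (length row) _
length≤maxCol (row ∷ T) (suc n) e    = ℕₚ.≤-trans (length≤maxCol T n e) (ℕₚ.m≤n⊔m (length row) _)

entry-just⁻ : ∀ T r c {v} → entry T r c ≡ just v →
  ∃₂ λ r′ c′ → ∃ λ row → r ≡ suc r′ × c ≡ suc c′ × nth T r′ ≡ just row × nth row c′ ≡ just v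
entry-just⁻ T (suc r) (suc c) e with nth T r in row≡
... | just row = r , c , row , refl , refl , row≡ , e

nth-pred : ∀ {A : Set} (xs : List A) n {y} → nth xs (suc n) ≡ just y → ∃ λ t → nth xs n ≡ just t
nth-pred (x ∷ _ ∷ _) zero    _ = x , refl
nth-pred (_ ∷ xs)    (suc n) e = nth-pred xs n e

entry-left : ∀ T r c {y} → entry T r (suc (suc c)) ≡ just y → ∃ λ t → entry T r (suc c) ≡ just t
entry-left T zero    c ()
entry-left T (suc r) c e with nth T r
... | just row = nth-pred row c e

-- `imapRows` is implemented by `where`-bound functions; generalising the arguments
-- of their calls (by `with`) in `go-spec` and `goRow-spec` makes unification name them.
private
  tail : Tableau → Tableau
  tail []       = []
  tail (_ ∷ xs) = xs

  head : Tableau → List ℕ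
  head []      = []
  head (x ∷ _) = x

  mutual
    go : (ℕ → ℕ → ℕ → ℕ) → Tableau → ℕ → Tableau → Tableau
    go = _

    go-spec : ∀ f T k row rows → T ≡ row ∷ rows → k ≡ 2 →
              tail (imapRows f (row ∷ rows)) ≡ go f T k rows
    go-spec f T k row rows T≡ k≡ with Tableau ∋ row ∷ rows | 2
    ... | _ | _ with T≡ | k≡
    ... | refl | refl = refl

  mutual
    goRow : (ℕ → ℕ → ℕ → ℕ) → Tableau → ℕ → ℕ → List ℕ → List ℕ
    goRow = _

    goRow-spec : ∀ f T r c row₁ row rows → T ≡ row₁ ∷ row ∷ rows → r ≡ 2 → c ≡ 1 →
                 head (tail (imapRows f (row₁ ∷ row ∷ rows))) ≡ goRow f T r c row
    goRow-spec f T r c row₁ row rows T≡ r≡ c≡ with Tableau ∋ row₁ ∷ row ∷ rows | 2 | 1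
    ... | _ | _ | _ with T≡ | r≡ | c≡
    ... | refl | refl | refl = refl

module _ (f : ℕ → ℕ → ℕ → ℕ) (T : Tableau) where

  private
    nth-goRow : ∀ r k row n → nth (goRow f T r k row) n ≡ Maybe.map (f r (n + k)) (nth row n)
    nth-goRow r k []       n       = refl
    nth-goRow r k (v ∷ vs) zero    = refl
    nth-goRow r k (v ∷ vs) (suc n) rewrite nth-goRow r (suc k) vs n | ℕₚ.+-suc n k = refl

    nth-go : ∀ k rows n → nth (go f T k rows) n ≡ Maybe.map (goRow f T (n + k) 1) (nth rows n)
    nth-go k []         n       = refl
    nth-go k (row ∷ rs) zero    = refl
    nth-go k (row ∷ rs) (suc n) rewrite nth-go (suc k) rs n | ℕₚ.+-suc n k = refl

    length-goRow : ∀ r k row → length (goRow f T r k row) ≡ length row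
    length-goRow r k []       = refl
    length-goRow r k (v ∷ vs) = cong suc (length-goRow r (suc k) vs)

    shape-go : ∀ k rows → map length (go f T k rows) ≡ map length rows
    shape-go k []         = refl
    shape-go k (row ∷ rs) = cong₂ _∷_ (length-goRow k 1 row) (shape-go (suc k) rs)

  shape-imapRows : shape (imapRows f T) ≡ shape T
  shape-imapRows = shape-go 1 T

  entry-imapRows : ∀ r c → entry (imapRows f T) r c ≡ Maybe.map (f r c) (entry T r c)
  entry-imapRows zero    c       = refl
  entry-imapRows (suc r) zero    = refl
  entry-imapRows (suc r) (suc c) rewrite nth-go 1 T r with nth T r
  ... | nothing  = refl
  ... | just row rewrite nth-goRow (r + 1) 1 row c | ℕₚ.+-comm r 1 | ℕₚ.+-comm c 1 = refl

-- The suffix counts m_i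

Neutral : ℕ → ℕ → Set
Neutral i v = v ≢ i × v ≢ suc i

private
  count-hit : ∀ {a} x xs → Letter.val x ≡ a → count a (x ∷ xs) ≡ suc (count a xs)
  count-hit x xs e rewrite ≡ᵇ-true e = refl

  count-miss : ∀ {a} x xs → Letter.val x ≢ a → count a (x ∷ xs) ≡ count a xs
  count-miss x xs e rewrite ≡ᵇ-false e = refl

module SuffixCounts (i : ℕ) where

  mSuffix-suc : ∀ x xs → Letter.val x ≡ suc i → mSuffix i (x ∷ xs) ≡ + 1 ℤ.+ mSuffix i xs
  mSuffix-suc x xs x≡
    rewrite count-hit x xs x≡ | count-miss x xs (ℕₚ.1+n≢n ∘ trans (sym x≡))
    = shift (+ count (suc i) xs) (+ count i xs)
    where
    shift : ∀ (a b : ℤ) → (+ 1 ℤ.+ a) - b ≡ + 1 ℤ.+ (a - b)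
    shift = solve-∀

  mSuffix-i : ∀ x xs → Letter.val x ≡ i → mSuffix i xs ≡ + 1 ℤ.+ mSuffix i (x ∷ xs)
  mSuffix-i x xs x≡
    rewrite count-hit x xs x≡ | count-miss x xs (ℕₚ.1+n≢n ∘ sym ∘ trans (sym x≡))
    = shift (+ count (suc i) xs) (+ count i xs)
    where
    shift : ∀ (a b : ℤ) → a - b ≡ + 1 ℤ.+ (a - (+ 1 ℤ.+ b))
    shift = solve-∀

  mSuffix-neutral : ∀ x xs → Neutral i (Letter.val x) → mSuffix i (x ∷ xs) ≡ mSuffix i xs
  mSuffix-neutral x xs (≢i , ≢suc) rewrite count-miss x xs ≢i | count-miss x xs ≢suc = refl

  mSuffix-++-neutral : ∀ ys zs → All (Neutral i ∘ Letter.val) ys → mSuffix i (ys ++ zs) ≡ mSuffix i zs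
  mSuffix-++-neutral []       zs []       = refl
  mSuffix-++-neutral (y ∷ ys) zs (n ∷ ns) =
    trans (mSuffix-neutral y (ys ++ zs) n) (mSuffix-++-neutral ys zs ns)

  mSuffix≤mMax : ∀ xs ys → mSuffix i ys ℤ.≤ mMax i (xs ++ ys)
  mSuffix≤mMax []       []       = ℤₚ.≤-refl
  mSuffix≤mMax []       (y ∷ ys) = ℤₚ.i≤i⊔j _ _
  mSuffix≤mMax (x ∷ xs) ys       = ℤₚ.≤-trans (mSuffix≤mMax xs ys) (ℤₚ.i≤j⊔i _ _)

  NoSuffixWith : ℤ → List Letter → Set
  NoSuffixWith M ys = ∀ xs zs → ys ≡ xs ++ zs → mSuffix i zs ≢ M

  lastWith-nothing : ∀ {M} w → M ≢ + 0 → lastWith M (mList i w) ≡ nothing → NoSuffixWith M w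
  lastWith-nothing []      M≢0 _    [] [] refl m≡M = M≢0 (sym m≡M)
  lastWith-nothing {M} (x ∷ w) M≢0 none xs zs w≡ with lastWith M (mList i w) in none′
  lastWith-nothing (x ∷ w) M≢0 () xs zs w≡ | just _
  ... | nothing with mSuffix i (x ∷ w) ℤ.≟ M
  lastWith-nothing (x ∷ w) M≢0 () xs zs w≡ | nothing | yes _
  ... | no m≢M with xs | w≡
  ... | []     | refl = m≢M
  ... | _ ∷ xs′ | refl = lastWith-nothing w M≢0 none′ xs′ zs refl

  lastWith-just : ∀ {M} w {l} → M ≢ + 0 → lastWith M (mList i w) ≡ just l →
    ∃₂ λ xs ys → w ≡ xs ++ l ∷ ys × mSuffix i (l ∷ ys) ≡ M × NoSuffixWith M ys
  lastWith-just {M} (x ∷ w) M≢0 found with lastWith M (mList i w) in found′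
  lastWith-just (x ∷ w) M≢0 refl | just y with lastWith-just w M≢0 found′
  ... | xs , ys , refl , m≡M , none = x ∷ xs , ys , refl , m≡M , none
  lastWith-just {M} (x ∷ w) M≢0 found | nothing with mSuffix i (x ∷ w) ℤ.≟ M
  lastWith-just (x ∷ w) M≢0 refl | nothing | yes m≡M =
    [] , w , refl , m≡M , lastWith-nothing w M≢0 found′
  lastWith-just (x ∷ w) M≢0 () | nothing | no _

  -- An i after l preceded only by neutral letters would be followed by a suffix on which
  -- m_i again takes its maximum.
  raisingLetter : ∀ w {l} → + 0 ℤ.< mMax i w → lastWith (mMax i w) (mList i w) ≡ just l →
    ∃₂ λ xs ys → w ≡ xs ++ l ∷ ys × Letter.val l ≡ suc i ×
      (∀ ys₁ p ys₂ → ys ≡ ys₁ ++ p ∷ ys₂ → All (Neutral i ∘ Letter.val) ys₁ → Letter.val p ≢ i)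
  raisingLetter w {l} m>0 found with lastWith-just w (ℤₚ.<⇒≢ m>0 ∘ sym) found
  ... | xs , ys , refl , m≡M , none = xs , ys , refl , l≡suc , firstNotI
    where
    M = mMax i (xs ++ l ∷ ys)

    m<M : mSuffix i ys ℤ.< M
    m<M = ℤₚ.≤∧≢⇒<
      (subst (λ u → mSuffix i ys ℤ.≤ mMax i u) (++-assoc xs [ l ] ys) (mSuffix≤mMax (xs ++ [ l ]) ys))
      (none [] ys refl)

    l≡suc : Letter.val l ≡ suc i
    l≡suc with Letter.val l ℕₚ.≟ suc i | Letter.val l ℕₚ.≟ i
    ... | yes l≡ | _     = l≡
    ... | no l≢  | yes l≡ = contradiction
      (ℤₚ.≤-<-trans (ℤₚ.i≤j+i M (+ 1))
        (subst (ℤ._< M) (trans (mSuffix-i l ys l≡) (cong (ℤ._+_ (+ 1)) m≡M)) m<M))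
      (ℤₚ.<-irrefl refl)
    ... | no l≢  | no l≢′ =
      ⊥-elim (ℤₚ.<-irrefl m≡M (subst (ℤ._< M) (sym (mSuffix-neutral l ys (l≢′ , l≢))) m<M))

    firstNotI : ∀ ys₁ p ys₂ → ys ≡ ys₁ ++ p ∷ ys₂ → All (Neutral i ∘ Letter.val) ys₁ → Letter.val p ≢ i
    firstNotI ys₁ p ys₂ refl neutral p≡ = none (ys₁ ++ [ p ]) ys₂ (sym (++-assoc ys₁ [ p ] ys₂)) (begin
      mSuffix i ys₂                          ≡⟨ mSuffix-i p ys₂ p≡ ⟩
      + 1 ℤ.+ mSuffix i (p ∷ ys₂)            ≡⟨ cong (ℤ._+_ (+ 1)) (mSuffix-++-neutral ys₁ (p ∷ ys₂) neutral) ⟨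
      + 1 ℤ.+ mSuffix i (ys₁ ++ p ∷ ys₂)     ≡⟨ mSuffix-suc l (ys₁ ++ p ∷ ys₂) l≡suc ⟨
      mSuffix i (l ∷ ys₁ ++ p ∷ ys₂)         ≡⟨ m≡M ⟩
      M                                      ∎)
      where open ≡-Reasoning

-- The reverse column reading word

-- (r′, c′) is read after (r, c) by `colWord`: columns right to left, each one top to bottom.
ReadBefore : ℕ → ℕ → ℕ → ℕ → Set
ReadBefore r c r′ c′ = ×-Lex _≡_ _>_ _>_ (c , r) (c′ , r′)

_≺_ : Letter → Letter → Set
x ≺ y = ReadBefore (Letter.row x) (Letter.col x) (Letter.row y) (Letter.col y)

≺-asym : Asymmetric _≺_
≺-asym {x} {y} = ×-asymmetric {_≈₁_ = _≡_} {_<₁_ = _>_} {_<₂_ = _>_}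
  sym (resp₂ _>_) ℕₚ.<-asym ℕₚ.<-asym {Letter.col x , Letter.row x} {Letter.col y , Letter.row y}

-- `colWord` reads boxes through a `where`-bound function; unification names it.
private
  cellReader : Σ (Tableau → ℕ → ℕ → List Letter) λ cell → ∀ T →
    colWord T ≡ concatMap (λ c → concatMap (λ r → cell T r c) (down1 (length T))) (down1 (maxCol T))
  cellReader = _ , λ _ → refl

cell : Tableau → ℕ → ℕ → List Letter
cell = proj₁ cellReader

cell-nothing-or-just : ∀ T r c →
  (entry T r c ≡ nothing × cell T r c ≡ []) ⊎
  (∃ λ v → entry T r c ≡ just v × cell T r c ≡ letter r c v ∷ [])
cell-nothing-or-just T r c with entry T r c
... | nothing = inj₁ (refl , refl)
... | just v  = inj₂ (v , refl , refl)

∈-cell⁻ : ∀ T r c {x} → x ∈ cell T r c →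
  Letter.row x ≡ r × Letter.col x ≡ c × entry T r c ≡ just (Letter.val x)
∈-cell⁻ T r c x∈ with cell-nothing-or-just T r c
... | inj₁ (_ , empty) rewrite empty with x∈
...   | ()
∈-cell⁻ T r c x∈ | inj₂ (v , e , single) rewrite single with x∈
...   | here refl = refl , refl , e

∈-cell⁺ : ∀ T r c {v} → entry T r c ≡ just v → letter r c v ∈ cell T r c
∈-cell⁺ T r c e with cell-nothing-or-just T r c
... | inj₁ (none , _) = case trans (sym e) none of λ ()
... | inj₂ (w , e′ , single) rewrite single | just-injective (trans (sym e) e′) = here refl

column : Tableau → ℕ → List Letter
column T c = concatMap (λ r → cell T r c) (down1 (length T))

∈-column⁻ : ∀ T c {x} → x ∈ column T c →
  Letter.col x ≡ c × entry T (Letter.row x) (Letter.col x) ≡ just (Letter.val x)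
∈-column⁻ T c x∈ with Any.satisfied (∈-concatMap⁻ (λ r → cell T r c) {down1 (length T)} x∈)
... | r , x∈cell with ∈-cell⁻ T r c x∈cell
...   | refl , refl , e = refl , e

colWord-sound : ∀ T {x} → x ∈ colWord T → entry T (Letter.row x) (Letter.col x) ≡ just (Letter.val x)
colWord-sound T x∈ =
  proj₂ (∈-column⁻ T _ (proj₂ (Any.satisfied (∈-concatMap⁻ (column T) {down1 (maxCol T)} x∈))))

∈-down1⁻ : ∀ n {k} → k ∈ down1 n → k ≤ n
∈-down1⁻ (suc n) (here refl) = ℕₚ.≤-refl
∈-down1⁻ (suc n) (there k∈) = ℕₚ.m≤n⇒m≤1+n (∈-down1⁻ n k∈)

∈-down1⁺ : ∀ n {k} → k < n → suc k ∈ down1 n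
∈-down1⁺ (suc n) (s≤s k≤n) with ℕₚ.m≤n⇒m<n∨m≡n k≤n
... | inj₁ k<n  = there (∈-down1⁺ n k<n)
... | inj₂ refl = here refl

down1-sorted : ∀ n → AllPairs _>_ (down1 n)
down1-sorted zero    = []
down1-sorted (suc n) = All.tabulate (s≤s ∘ ∈-down1⁻ n) ∷ down1-sorted n

column-sorted : ∀ T c → AllPairs _≺_ (column T c)
column-sorted T c = AllPairs-concatMap⁺ (λ r → cell T r c) (down1-sorted (length T)) cell-sorted higher-first
  where
  cell-sorted : ∀ r → AllPairs _≺_ (cell T r c)
  cell-sorted r with cell-nothing-or-just T r c
  ... | inj₁ (_ , empty)      rewrite empty  = []
  ... | inj₂ (_ , _ , single) rewrite single = All.[] ∷ []

  higher-first : ∀ {a b x y} → a > b → x ∈ cell T a c → y ∈ cell T b c → x ≺ y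
  higher-first a>b x∈ y∈ with ∈-cell⁻ T _ c x∈ | ∈-cell⁻ T _ c y∈
  ... | refl , refl , _ | refl , refl , _ = inj₂ (refl , a>b)

colWord-sorted : ∀ T → AllPairs _≺_ (colWord T)
colWord-sorted T = AllPairs-concatMap⁺ (column T) (down1-sorted (maxCol T)) (column-sorted T) right-first
  where
  right-first : ∀ {a b x y} → a > b → x ∈ column T a → y ∈ column T b → x ≺ y
  right-first a>b x∈ y∈ with ∈-column⁻ T _ x∈ | ∈-column⁻ T _ y∈
  ... | refl , _ | refl , _ = inj₁ a>b

colWord-complete : ∀ T r c {v} → entry T r c ≡ just v → letter r c v ∈ colWord T
colWord-complete T r c e with entry-just⁻ T r c e
... | r′ , c′ , row , refl , refl , row≡ , v≡ =
  ∈-concatMap⁺ (column T) (lose c∈ (∈-concatMap⁺ (λ r → cell T r (suc c′)) (lose r∈ (∈-cell⁺ T r c e))))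
  where
  c∈ : suc c′ ∈ down1 (maxCol T)
  c∈ = ∈-down1⁺ (maxCol T) (ℕₚ.<-≤-trans (nth-just⇒< row c′ v≡) (length≤maxCol T r′ row≡))
  r∈ : suc r′ ∈ down1 (length T)
  r∈ = ∈-down1⁺ (length T) (nth-just⇒< T r′ row≡)

NoIFollows : ℕ → Tableau → ℕ → ℕ → Set
NoIFollows i T r₀ c₀ = ∀ r c → entry T r c ≡ just i → ReadBefore r₀ c₀ r c →
  ¬ (∀ r′ c′ v′ → ReadBefore r₀ c₀ r′ c′ → ReadBefore r′ c′ r c → entry T r′ c′ ≡ just v′ → Neutral i v′)

raisingBox : ∀ i T {l} → + 0 ℤ.< mMax i (colWord T) →
  lastWith (mMax i (colWord T)) (mList i (colWord T)) ≡ just l →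
  entry T (Letter.row l) (Letter.col l) ≡ just (suc i) × NoIFollows i T (Letter.row l) (Letter.col l)
raisingBox i T {l} m>0 found with SuffixCounts.raisingLetter i (colWord T) m>0 found
... | xs , ys , w≡ , l≡ , firstNotI =
  subst (λ v → entry T (Letter.row l) (Letter.col l) ≡ just v) l≡
    (colWord-sound T (inWord (∈-++⁺ʳ xs (here refl)))) ,
  noIFollows
  where
  inWord : ∀ {z} → z ∈ xs ++ l ∷ ys → z ∈ colWord T
  inWord = subst (_ ∈_) (sym w≡)

  noIFollows : NoIFollows i T (Letter.row l) (Letter.col l)
  noIFollows r c e l≺p neutral
    with AllPairs-between (λ {x} {y} → ≺-asym {x} {y}) xs (subst (AllPairs _≺_) w≡ (colWord-sorted T))
                          (subst (_ ∈_) w≡ (colWord-complete T r c e)) l≺p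
  ... | ys₁ , ys₂ , refl , between = firstNotI ys₁ (letter r c i) ys₂ refl
    (All.tabulate λ {z} z∈ → neutral (Letter.row z) (Letter.col z) (Letter.val z)
      (proj₁ (All.lookup between z∈)) (proj₂ (All.lookup between z∈))
      (colWord-sound T (inWord (∈-++⁺ʳ xs (there (∈-++⁺ˡ z∈))))))
    refl

-- Raising a key tableau

module RaiseAt (T : Tableau) (key : IsKey T) (i r₀ c₀ : ℕ)
               (b₀ : entry T r₀ c₀ ≡ just (suc i)) (noIFollows : NoIFollows i T r₀ c₀) where

  -- Unlike `entry T r c ≡ just v`, a proof of `Has r c v` determines r, c and v.
  data Has (r c v : ℕ) : Set where
    has : entry T r c ≡ just v → Has r c v

  row-step : ∀ {r c x y} → Has r c x → Has r (suc c) y → y ≤ x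
  row-step {r} {c} {x} {y} (has e) (has e′) = proj₁ key r c x y e e′

  column-distinct : ∀ {a b j x y} → a < b → Has a j x → Has b j y → x ≢ y
  column-distinct {a} {b} {j} {x} {y} a<b (has e) (has e′) = proj₁ (proj₂ key) a b j x y a<b e e′

  inversion-right : ∀ {a b j x y} → a < b → Has a j x → Has b j y → y < x →
                    ∃ λ z → Has a (suc j) z × y < z
  inversion-right {a} {b} {j} {x} {y} a<b (has e) (has e′) y<x
    with proj₂ (proj₂ key) a b j x y a<b e e′ y<x
  ... | z , e″ , y<z = z , has e″ , y<z

  Has-functional : ∀ {r c v w} → Has r c v → Has r c w → v ≡ w
  Has-functional (has e) (has e′) = just-injective (trans (sym e) e′)

  column-injective : ∀ {a b j x} → Has a j x → Has b j x → a ≡ b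
  column-injective {a} {b} ha hb with ℕₚ.<-cmp a b
  ... | tri< a<b _ _ = ⊥-elim (column-distinct a<b ha hb refl)
  ... | tri≈ _ a≡b _ = a≡b
  ... | tri> _ _ b<a = ⊥-elim (column-distinct b<a hb ha refl)

  Has-indices : ∀ {r c v} → Has r c v → 1 ≤ r × 1 ≤ c
  Has-indices {r} {c} (has e) with entry-just⁻ T r c e
  ... | _ , _ , _ , refl , refl , _ = s≤s z≤n , s≤s z≤n

  Has-left : ∀ {r c y} → Has r (suc c) y → 1 ≤ c → ∃ (Has r c)
  Has-left {r} {suc c} (has e) _ with entry-left T r c e
  ... | t , e′ = t , has e′

  row-antitone : ∀ {r c c′ x y} → Has r c x → c ≤ c′ → Has r c′ y → y ≤ x
  row-antitone {c′ = zero} _ _ hy with Has-indices hy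
  ... | _ , ()
  row-antitone {c = c} {c′ = suc d} hx c≤c′ hy with c ℕₚ.≤? d
  ... | yes c≤d with Has-left hy (ℕₚ.≤-trans (proj₂ (Has-indices hx)) c≤d)
  ...   | t , ht = ℕₚ.≤-trans (row-step ht hy) (row-antitone hx c≤d ht)
  row-antitone hx c≤c′ hy | no c≰d with ℕₚ.≤-antisym c≤c′ (ℕₚ.≰⇒> c≰d)
  ...   | refl = ℕₚ.≤-reflexive (Has-functional hy hx)

  b₀-Has : Has r₀ c₀ (suc i)
  b₀-Has = has b₀

  Lowered : ℕ → Set
  Lowered c = c₀ ≤ c × Has r₀ c (suc i)

  Lowered-left : ∀ {c} → Lowered (suc c) → c₀ ≤ c → Lowered c
  Lowered-left (_ , h) c₀≤c with Has-left h (ℕₚ.≤-trans (proj₂ (Has-indices b₀-Has)) c₀≤c)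
  ... | t , ht = c₀≤c , subst (Has r₀ _) (ℕₚ.≤-antisym (row-antitone b₀-Has c₀≤c ht) (row-step ht h)) ht

  Lowered-first : ∀ {c} → Lowered (suc c) → ¬ Lowered c → suc c ≡ c₀
  Lowered-first {c} low ¬low with c₀ ℕₚ.≤? c
  ... | yes c₀≤c = ⊥-elim (¬low (Lowered-left low c₀≤c))
  ... | no c₀≰c  = ℕₚ.≤-antisym (ℕₚ.≰⇒> c₀≰c) (proj₁ low)

  noI-below-b₀ : ∀ {r} → r < r₀ → ¬ Has r c₀ i
  noI-below-b₀ {r} r<r₀ hi@(has e) = noIFollows r c₀ e (inj₂ (refl , r<r₀)) neutral
    where
    neutral : ∀ r′ c′ v′ → ReadBefore r₀ c₀ r′ c′ → ReadBefore r′ c′ r c₀ → entry T r′ c′ ≡ just v′ →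
              Neutral i v′
    neutral r′ c′ v′ (inj₁ c′<c₀)       (inj₁ c₀<c′)       _  = ⊥-elim (ℕₚ.<-asym c′<c₀ c₀<c′)
    neutral r′ c′ v′ (inj₁ c′<c₀)       (inj₂ (refl , _))  _  = ⊥-elim (ℕₚ.<-irrefl refl c′<c₀)
    neutral r′ c′ v′ (inj₂ (refl , _))  (inj₁ c₀<c′)       _  = ⊥-elim (ℕₚ.<-irrefl refl c₀<c′)
    neutral r′ c′ v′ (inj₂ (refl , r′<r₀)) (inj₂ (_ , r<r′)) e′ =
      (λ { refl → ℕₚ.<-irrefl (column-injective hi (has e′)) r<r′ }) ,
      (λ { refl → ℕₚ.<-irrefl (column-injective (has e′) b₀-Has) r′<r₀ })

  -- Induction along the lowered boxes: the left neighbour of an i at (r, c + 1) with r < r₀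
  -- exceeds the i + 1 at (r₀, c), so condition (c) would force an entry above i + 1 at (r, c + 1).
  noI-below : ∀ {c r} → Lowered c → r < r₀ → ¬ Has r c i
  noI-below {zero} (_ , h) _ _ with Has-indices h
  ... | _ , ()
  noI-below {suc d} {r} low r<r₀ hi with c₀ ℕₚ.≤? d
  ... | no c₀≰d = noI-below-b₀ r<r₀ (subst (λ c → Has r c i) (ℕₚ.≤-antisym (ℕₚ.≰⇒> c₀≰d) (proj₁ low)) hi)
  ... | yes c₀≤d with Lowered-left low c₀≤d | Has-left hi (ℕₚ.≤-trans (proj₂ (Has-indices b₀-Has)) c₀≤d)
  ...   | lowD | u , hu
    with inversion-right r<r₀ hu (proj₂ lowD) (ℕₚ.≤∧≢⇒< (ℕₚ.≤∧≢⇒< (row-step hu hi) u≢i) u≢suc)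
    where
    u≢i : i ≢ u
    u≢i refl = noI-below lowD r<r₀ hu
    u≢suc : suc i ≢ u
    u≢suc refl = ℕₚ.<-irrefl (column-injective hu (proj₂ lowD)) r<r₀
  ...     | z , hz , i+1<z = ℕₚ.<-asym i+1<z (subst (_< suc i) (Has-functional hi hz) (ℕₚ.n<1+n i))

  i-above-lowered : ∀ {c s} → Lowered c → Has s c i → r₀ < s
  i-above-lowered {c} {s} low hi with ℕₚ.<-cmp r₀ s
  ... | tri< r₀<s _ _ = r₀<s
  ... | tri≈ _ refl _ = ⊥-elim (ℕₚ.1+n≢n (Has-functional (proj₂ low) hi))
  ... | tri> _ _ s<r₀ = ⊥-elim (noI-below low s<r₀ hi)

  Lowered-suc : ∀ {c s} → Lowered c → Has s c i → Lowered (suc c)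
  Lowered-suc low hi with inversion-right (i-above-lowered low hi) (proj₂ low) hi (ℕₚ.n<1+n i)
  ... | z , hz , i<z = ℕₚ.m≤n⇒m≤1+n (proj₁ low) ,
    subst (Has r₀ _) (ℕₚ.≤-antisym (row-step (proj₂ low) hz) i<z) hz

  noI-left-above : ∀ {j b} → suc j ≡ c₀ → r₀ < b → ¬ Has b j i
  noI-left-above {j} {b} j+1≡c₀ r₀<b hi@(has e) =
    noIFollows b j e (inj₁ (subst (j <_) j+1≡c₀ (ℕₚ.n<1+n j))) neutral
    where
    b₀′ : Has r₀ (suc j) (suc i)
    b₀′ = subst (λ c → Has r₀ c (suc i)) (sym j+1≡c₀) b₀-Has

    noI+1-above : ∀ {r′} → b < r′ → ¬ Has r′ j (suc i)
    noI+1-above {r′} b<r′ h with Has-left b₀′ (proj₂ (Has-indices hi))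
    ... | t , ht with ℕₚ.m≤n⇒m<n∨m≡n (row-step ht b₀′)
    ...   | inj₂ refl = ℕₚ.<-irrefl (column-injective ht h) (ℕₚ.<-trans r₀<b b<r′)
    ...   | inj₁ i+1<t with inversion-right (ℕₚ.<-trans r₀<b b<r′) ht h i+1<t
    ...     | z , hz , i+1<z = ℕₚ.<-irrefl (Has-functional b₀′ hz) i+1<z

    neutral : ∀ r′ c′ v′ → ReadBefore r₀ c₀ r′ c′ → ReadBefore r′ c′ b j → entry T r′ c′ ≡ just v′ →
              Neutral i v′
    neutral r′ c′ v′ (inj₁ c′<c₀) (inj₁ j<c′) _ rewrite sym j+1≡c₀ =
      ⊥-elim (ℕₚ.<-irrefl refl (ℕₚ.<-≤-trans j<c′ (ℕₚ.≤-pred c′<c₀)))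
    neutral r′ c′ v′ (inj₁ _) (inj₂ (refl , b<r′)) e′ =
      (λ { refl → ℕₚ.<-irrefl (column-injective hi (has e′)) b<r′ }) ,
      (λ { refl → noI+1-above b<r′ (has e′) })
    neutral r′ c′ v′ (inj₂ (refl , r′<r₀)) (inj₁ _) e′ =
      (λ { refl → noI-below-b₀ r′<r₀ (has e′) }) ,
      (λ { refl → ℕₚ.<-irrefl (column-injective (has e′) b₀-Has) r′<r₀ })
    neutral r′ c′ v′ (inj₂ (refl , _)) (inj₂ (refl , _)) _ = ⊥-elim (ℕₚ.1+n≢n j+1≡c₀)

  -- The `where`-bound rule of `raise`, restated (definitionally equal) so that it can be analysed.
  step : ℕ → ℕ → ℕ → ℕ
  step r c v =
    if (r ≡ᵇ r₀) ∧ (c₀ ≤ᵇ c) ∧ (v ≡ᵇ suc i) then i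
    else if ((c₀ ≤ᵇ c) ∧ isJust≡ (entry T r₀ c) (suc i)) ∧ (v ≡ᵇ i) then suc i
    else v

  data StepView (r c v : ℕ) : Set where
    lowered : r ≡ r₀ → Lowered c → v ≡ suc i → step r c v ≡ i → StepView r c v
    raised  : Lowered c → v ≡ i → step r c v ≡ suc i → StepView r c v
    fixed   : ¬ (r ≡ r₀ × Lowered c) → ¬ (Lowered c × v ≡ i) → step r c v ≡ v → StepView r c v

  stepView : ∀ {r c v} → Has r c v → StepView r c v
  stepView {r} {c} {v} h with (r ≡ᵇ r₀) ∧ (c₀ ≤ᵇ c) ∧ (v ≡ᵇ suc i) in lowers
  ... | true with ∧-true⁻ lowers
  ...   | r≡ , rest with ∧-true⁻ rest
  ...     | c₀≤c , v≡ with ≡ᵇ-true⁻ r r₀ r≡ | ≡ᵇ-true⁻ v (suc i) v≡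
  ...       | refl | refl = lowered refl (≤ᵇ-true⁻ c₀ c c₀≤c , h) refl (if-true lowers)
  stepView {r} {c} {v} h | false with ((c₀ ≤ᵇ c) ∧ isJust≡ (entry T r₀ c) (suc i)) ∧ (v ≡ᵇ i) in raises
  ... | true with ∧-true⁻ raises
  ...   | col , v≡ with ∧-true⁻ col
  ...     | c₀≤c , r₀c≡ =
    raised (≤ᵇ-true⁻ c₀ c c₀≤c , has (isJust≡-true⁻ _ r₀c≡)) (≡ᵇ-true⁻ v i v≡)
      (trans (if-false lowers) (if-true raises))
  stepView {r} {c} {v} h | false | false =
    fixed notLowered notRaised (trans (if-false lowers) (if-false raises))
    where
    notLowered : ¬ (r ≡ r₀ × Lowered c)
    notLowered (refl , c₀≤c , h₀) with Has-functional h h₀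
    ... | refl with trans (sym lowers)
                  (cong₂ _∧_ (≡ᵇ-true {r₀} refl) (cong₂ _∧_ (≤ᵇ-true c₀ c c₀≤c) (≡ᵇ-true {suc i} refl)))
    ...   | ()
    notRaised : ¬ (Lowered c × v ≡ i)
    notRaised ((c₀≤c , has e₀) , refl)
      with trans (sym raises) (cong₂ _∧_
             (cong₂ _∧_ (≤ᵇ-true c₀ c c₀≤c) (trans (cong (λ m → isJust≡ m (suc i)) e₀) (≡ᵇ-true {suc i} refl)))
             (≡ᵇ-true {i} refl))
    ... | ()

  T′ : Tableau
  T′ = imapRows step T

  entry′⁻ : ∀ r c {x} → entry T′ r c ≡ just x → ∃ λ v → Has r c v × step r c v ≡ x
  entry′⁻ r c e with entry T r c in e₀ | trans (sym (entry-imapRows step T r c)) e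
  ... | just v | refl = v , has e₀ , refl

  entry′⁺ : ∀ {r c v} → Has r c v → entry T′ r c ≡ just (step r c v)
  entry′⁺ {r} {c} (has e) = trans (entry-imapRows step T r c) (cong (Maybe.map (step r c)) e)

  step-row-step : ∀ {r c v w} → Has r c v → Has r (suc c) w → StepView r c v → StepView r (suc c) w →
                  step r (suc c) w ≤ step r c v
  step-row-step hv hw (lowered refl _ _ _) (raised low w≡i _) =
    ⊥-elim (ℕₚ.1+n≢n (trans (Has-functional (proj₂ low) hw) w≡i))
  step-row-step hv hw (lowered _ _ _ s) (lowered _ _ _ s′) rewrite s | s′ = ℕₚ.≤-refl
  step-row-step hv hw (lowered refl low refl s) (fixed ¬low _ s′) rewrite s | s′ =
    ℕₚ.≤-pred (ℕₚ.≤∧≢⇒< (row-step hv hw) λ { refl → ¬low (refl , ℕₚ.m≤n⇒m≤1+n (proj₁ low) , hw) })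
  step-row-step hv hw (raised _ _ s) (raised _ _ s′) rewrite s | s′ = ℕₚ.≤-refl
  step-row-step hv hw (raised _ refl s) (lowered _ _ _ s′) rewrite s | s′ = ℕₚ.n≤1+n _
  step-row-step hv hw (raised _ refl s) (fixed _ _ s′) rewrite s | s′ = ℕₚ.≤-trans (row-step hv hw) (ℕₚ.n≤1+n _)
  step-row-step {r} {c} hv hw (fixed _ ¬raised s) (raised low refl s′) rewrite s | s′ =
    ℕₚ.≤∧≢⇒< (row-step hv hw) v≢i
    where
    v≢i : i ≢ _
    v≢i refl with c₀ ℕₚ.≤? c
    ... | yes c₀≤c = ¬raised (Lowered-left low c₀≤c , refl)
    ... | no c₀≰c  = noI-left-above (ℕₚ.≤-antisym (ℕₚ.≰⇒> c₀≰c) (proj₁ low)) (i-above-lowered low hw) hv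
  step-row-step hv hw (fixed _ _ s) (lowered _ _ refl s′) rewrite s | s′ = ℕₚ.≤-trans (ℕₚ.n≤1+n _) (row-step hv hw)
  step-row-step hv hw (fixed _ _ s) (fixed _ _ s′) rewrite s | s′ = row-step hv hw

  step-column-distinct : ∀ {a b j v w} → a < b → Has a j v → Has b j w → StepView a j v → StepView b j w →
                         step a j v ≢ step b j w
  step-column-distinct a<b hv hw (lowered refl _ _ _) (lowered refl _ _ _) _ = ℕₚ.<-irrefl refl a<b
  step-column-distinct a<b hv hw (lowered _ _ _ s) (raised _ _ s′) rewrite s | s′ = ℕₚ.1+n≢n ∘ sym
  step-column-distinct a<b hv hw (lowered _ low _ s) (fixed _ ¬raised s′) rewrite s | s′ = λ e → ¬raised (low , sym e)
  step-column-distinct a<b hv hw (raised _ _ s) (lowered _ _ _ s′) rewrite s | s′ = ℕₚ.1+n≢n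
  step-column-distinct a<b hv hw (raised _ refl _) (raised _ refl _) _ = column-distinct a<b hv hw refl
  step-column-distinct a<b hv hw (raised low _ s) (fixed ¬lowered _ s′) rewrite s | s′ =
    λ e → ¬lowered (column-injective (subst (Has _ _) (sym e) hw) (proj₂ low) , low)
  step-column-distinct a<b hv hw (fixed _ ¬raised s) (lowered _ low _ s′) rewrite s | s′ = λ e → ¬raised (low , e)
  step-column-distinct a<b hv hw (fixed ¬lowered _ s) (raised low _ s′) rewrite s | s′ =
    λ e → ¬lowered (column-injective (subst (Has _ _) e hv) (proj₂ low) , low)
  step-column-distinct a<b hv hw (fixed _ _ s) (fixed _ _ s′) rewrite s | s′ = column-distinct a<b hv hw

  GreaterRight′ : ℕ → ℕ → ℕ → Set
  GreaterRight′ a j y = ∃ λ z → entry T′ a (suc j) ≡ just z × y < z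

  greaterRight′ : ∀ {a j u y z} → Has a (suc j) u → step a (suc j) u ≡ z → y < z → GreaterRight′ a j y
  greaterRight′ hu refl y<z = _ , entry′⁺ hu , y<z

  inversion′-lowered : ∀ {b j w} → r₀ < b → Has r₀ j (suc i) → Has b j w → StepView b j w →
    step b j w < i → GreaterRight′ r₀ j (step b j w)
  inversion′-lowered r₀<b hv hw (lowered refl _ _ _) _ = ⊥-elim (ℕₚ.<-irrefl refl r₀<b)
  inversion′-lowered r₀<b hv hw (raised _ _ s) l rewrite s = ⊥-elim (ℕₚ.<-asym l (ℕₚ.n<1+n _))
  inversion′-lowered r₀<b hv hw (fixed _ _ s) l rewrite s
    with inversion-right r₀<b hv hw (ℕₚ.<-trans l (ℕₚ.n<1+n _))
  ... | u , hu , w<u with stepView hu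
  ...   | lowered _ _ _ s′ = greaterRight′ hu s′ l
  ...   | raised _ _ s′    = greaterRight′ hu s′ (ℕₚ.<-trans l (ℕₚ.n<1+n _))
  ...   | fixed _ _ s′     = greaterRight′ hu s′ w<u

  inversion′-raised : ∀ {a b j w} → a < b → Lowered j → Has a j i → Has b j w → StepView b j w →
    step b j w < suc i → GreaterRight′ a j (step b j w)
  inversion′-raised a<b low hv hw (lowered refl _ _ _) _ = ⊥-elim (noI-below low a<b hv)
  inversion′-raised a<b low hv hw (raised _ _ s) l rewrite s = ⊥-elim (ℕₚ.<-irrefl refl l)
  inversion′-raised {a} {j = j} a<b low hv hw (fixed _ _ s) l rewrite s
    with inversion-right a<b hv hw (ℕₚ.≤∧≢⇒< (ℕₚ.≤-pred l) (column-distinct a<b hv hw ∘ sym))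
  ... | u , hu , w<u with stepView hu
  ...   | lowered a≡r₀ _ _ _ =
    ⊥-elim (ℕₚ.1+n≢n (Has-functional (proj₂ low) (subst (λ r → Has r j i) a≡r₀ hv)))
  ...   | raised _ refl s′ = greaterRight′ hu s′ (ℕₚ.m<n⇒m<1+n w<u)
  ...   | fixed _ _ s′     = greaterRight′ hu s′ w<u

  inversion′-fixed : ∀ {a b j v w} → a < b → Has a j v → Has b j w → ¬ (a ≡ r₀ × Lowered j) →
    StepView b j w → step b j w < v → GreaterRight′ a j (step b j w)
  inversion′-fixed a<b hv hw _ (lowered refl _ refl s) l rewrite s
    with inversion-right a<b hv hw (ℕₚ.≤∧≢⇒< l (column-distinct a<b hv hw ∘ sym))
  ... | u , hu , i+1<u with stepView hu
  ...   | lowered refl _ _ _ = ⊥-elim (ℕₚ.<-irrefl refl a<b)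
  ...   | raised _ refl _    = ⊥-elim (ℕₚ.<-asym i+1<u (ℕₚ.n<1+n _))
  ...   | fixed _ _ s′       = greaterRight′ hu s′ (ℕₚ.<-trans (ℕₚ.n<1+n _) i+1<u)
  inversion′-fixed a<b hv hw ¬lowered (raised low refl s) l rewrite s
    with inversion-right a<b hv hw (ℕₚ.<-trans (ℕₚ.n<1+n _) l)
  ... | u , hu , i<u with stepView hu
  ...   | lowered a≡r₀ _ _ _ = ⊥-elim (¬lowered (a≡r₀ , low))
  ...   | raised _ refl _    = ⊥-elim (ℕₚ.<-irrefl refl i<u)
  ...   | fixed _ _ s′       = greaterRight′ hu s′ (ℕₚ.≤∧≢⇒< i<u λ { refl →
    ¬lowered (column-injective hu (proj₂ (Lowered-suc low hw)) , low) })
  inversion′-fixed {b = b} a<b hv hw _ (fixed _ ¬raised s) l rewrite s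
    with inversion-right a<b hv hw l
  ... | u , hu , w<u with stepView hu
  ...   | lowered a≡r₀ low refl s′ = greaterRight′ hu s′ (ℕₚ.≤∧≢⇒< (ℕₚ.≤-pred w<u) λ { refl →
    noI-left-above (Lowered-first low (λ low′ → ¬raised (low′ , refl))) (subst (_< b) a≡r₀ a<b) hw })
  ...   | raised _ refl s′ = greaterRight′ hu s′ (ℕₚ.<-trans w<u (ℕₚ.n<1+n _))
  ...   | fixed _ _ s′     = greaterRight′ hu s′ w<u

  step-inversion-right : ∀ {a b j v w} → a < b → Has a j v → Has b j w → StepView a j v → StepView b j w →
    step b j w < step a j v → GreaterRight′ a j (step b j w)
  step-inversion-right a<b hv hw (lowered refl _ refl s) vb l rewrite s = inversion′-lowered a<b hv hw vb l
  step-inversion-right a<b hv hw (raised low refl s) vb l rewrite s = inversion′-raised a<b low hv hw vb l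
  step-inversion-right a<b hv hw (fixed ¬lowered _ s) vb l rewrite s = inversion′-fixed a<b hv hw ¬lowered vb l

  T′-isKey : IsKey T′
  T′-isKey = rows , columns , inversions
    where
    rows : ∀ r c x y → entry T′ r c ≡ just x → entry T′ r (suc c) ≡ just y → y ≤ x
    rows r c x y ex ey with entry′⁻ r c ex | entry′⁻ r (suc c) ey
    ... | v , hv , refl | w , hw , refl = step-row-step hv hw (stepView hv) (stepView hw)

    columns : ∀ a b j x y → a < b → entry T′ a j ≡ just x → entry T′ b j ≡ just y → x ≢ y
    columns a b j x y a<b ex ey with entry′⁻ a j ex | entry′⁻ b j ey
    ... | v , hv , refl | w , hw , refl = step-column-distinct a<b hv hw (stepView hv) (stepView hw)

    inversions : ∀ a b j x y → a < b → entry T′ a j ≡ just x → entry T′ b j ≡ just y → y < x →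
                 GreaterRight′ a j y
    inversions a b j x y a<b ex ey y<x with entry′⁻ a j ex | entry′⁻ b j ey
    ... | v , hv , refl | w , hw , refl = step-inversion-right a<b hv hw (stepView hv) (stepView hw) y<x

  T′-positive : 0 < i → PositiveFilling T → PositiveFilling T′
  T′-positive i>0 positive r c x ex with entry′⁻ r c ex
  ... | v , hv@(has e) , refl with stepView hv
  ...   | lowered _ _ _ s = subst (1 ≤_) (sym s) i>0
  ...   | raised _ _ s    = subst (1 ≤_) (sym s) (s≤s z≤n)
  ...   | fixed _ _ s     = subst (1 ≤_) (sym s) (positive r c v e)

  -- A raised entry i + 1 lies above row r₀, and i + 1 ≤ φ r₀ already.
  T′-flagged : ∀ {φ} → IsFlag φ → Flagged φ T → Flagged φ T′
  T′-flagged {φ} (monotone , _) flagged r c x ex with entry′⁻ r c ex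
  ... | v , hv@(has e) , refl with stepView hv
  ...   | lowered _ _ refl s = subst (_≤ φ r) (sym s) (ℕₚ.≤-trans (ℕₚ.n≤1+n _) (flagged r c v e))
  ...   | raised low refl s  = subst (_≤ φ r) (sym s) (ℕₚ.≤-trans (flagged r₀ c₀ (suc i) b₀)
          (monotone r₀ r (proj₁ (Has-indices b₀-Has)) (ℕₚ.<⇒≤ (i-above-lowered low hv))))
  ...   | fixed _ _ s        = subst (_≤ φ r) (sym s) (flagged r c v e)

  T′-SSKT : ∀ {α φ} → IsFlag φ → 0 < i → SSKT α φ T → SSKT α φ T′
  T′-SSKT flag i>0 (shape≡ , positive , _ , flagged) =
    trans (shape-imapRows step T) shape≡ , T′-positive i>0 positive , T′-isKey , T′-flagged flag flagged

proposition4p9 : (α : WeakComposition) (φ : ℕ → ℕ) → IsFlag φ → (i : ℕ) → 0 < i →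
    (T : Tableau) → SSKT α φ T →
    (raise i T ≡ nothing) ⊎ (Σ Tableau λ T' → raise i T ≡ just T' × SSKT α φ T')
proposition4p9 α φ flag i i>0 T sskt@(_ , _ , key , _) with + 0 ℤ.<? mMax i (colWord T)
... | no _ = inj₁ refl
... | yes m>0 with lastWith (mMax i (colWord T)) (mList i (colWord T)) in found
...   | nothing = inj₁ refl
...   | just (letter r₀ c₀ _) with raisingBox i T m>0 found
...     | b₀ , noIFollows = inj₂ (_ , refl , RaiseAt.T′-SSKT T key i r₀ c₀ b₀ noIFollows flag i>0 sskt)
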